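{- Let $M$ be a matroid and $e\in E(M)$. If $e$ is neither a loop nor a coloop of $M$, then $\kappa(M)\le \kappa(M/e)+\kappa(M\setminus e)$.
   Context: A non-basis of a matroid $M$ is a set of size $r(M)$ that is not a basis. A flat $F$ of $M$ covers a set $X$ if $|X\cap F|>r_M(F)$. A flat cover of $M$ is a set of flats of $M$ such that every non-basis of $M$ is covered by some member. The cover complexity $\kappa(M)$ is the minimum size of a flat cover of $M$. -}

module Defs where

open import Data.Nat using (ℕ; suc; _≤_; _<_; _+_; _∸_)
open import Data.Fin using (Fin)
open import Data.Fin.Subset using (Subset; _∪_; _∩_; _⊆_; ⁅_⁆; ∣_∣; _∈_; _∉_; ⊤; inside; outside)
open import Data.Vec using (insertAt)
open import Data.List using (List; length)
open import Data.List.Relation.Unary.All using (All)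
open import Data.List.Relation.Unary.Any using (Any)
open import Data.Product using (_×_; Σ)
open import Relation.Binary.PropositionalEquality using (_≡_)
open import Relation.Nullary using (¬_)

RankFn : ℕ → Set
RankFn n = Subset n → ℕ

record IsMatroid {n : ℕ} (r : RankFn n) : Set where
  field
    rank-≤-card : ∀ X → r X ≤ ∣ X ∣
    rank-mono   : ∀ X Y → X ⊆ Y → r X ≤ r Y
    rank-submod : ∀ X Y → r (X ∪ Y) + r (X ∩ Y) ≤ r X + r Y

module _ {n : ℕ} (r : RankFn n) where

  rankM : ℕ
  rankM = r ⊤

  Independent : Subset n → Set
  Independent X = r X ≡ ∣ X ∣

  IsBasis : Subset n → Set
  IsBasis B = Independent B × ∣ B ∣ ≡ rankM

  IsNonBasis : Subset n → Set
  IsNonBasis X = ∣ X ∣ ≡ rankM × ¬ IsBasis X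

  IsFlat : Subset n → Set
  IsFlat F = ∀ x → x ∉ F → r F < r (F ∪ ⁅ x ⁆)

  Covers : Subset n → Subset n → Set
  Covers F X = r F < ∣ X ∩ F ∣

  IsFlatCover : List (Subset n) → Set
  IsFlatCover C = All IsFlat C × (∀ X → IsNonBasis X → Any (λ F → Covers F X) C)

  IsCoverComplexity : ℕ → Set
  IsCoverComplexity k =
    Σ (List (Subset n)) (λ C → IsFlatCover C × length C ≡ k)
    × (∀ C → IsFlatCover C → k ≤ length C)

  IsLoop : Fin n → Set
  IsLoop e = ¬ Independent ⁅ e ⁆

  IsColoop : Fin n → Set
  IsColoop e = ∀ B → IsBasis B → e ∈ B

-- Deletion M \ e : ground set E - e, identified with Fin n via insertion at e.
delete : ∀ {n} → RankFn (suc n) → Fin (suc n) → RankFn n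
delete r e X = r (insertAt X e outside)

contract : ∀ {n} → RankFn (suc n) → Fin (suc n) → RankFn n
contract r e X = r (insertAt X e inside) ∸ r ⁅ e ⁆

-- Lift a minimum flat cover of M / e and one of M \ e to M: a flat F' of M / e gives the flat
-- F' ∪ e of M, and a flat F of M \ e gives its closure in M, which is F or F ∪ e and has the
-- rank of F. A non-basis X of M containing e is covered by the lift of a flat covering X − e
-- in M / e (this uses that e is not a loop), and one avoiding e is covered by the lift of a flat
-- covering X in M \ e (this uses that e is not a coloop, so r(M \ e) = r(M)).
module Submission where

open import Defs
open import Data.Nat using (ℕ; suc; _≤_; _+_)
open import Data.Fin using (Fin)
open import Relation.Nullary using (¬_)

open import Data.Bool using (true; false; _∧_; _∨_)
open import Data.Bool.Properties using (∨-identityʳ)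
import Data.Bool.Properties as Bool
open import Data.Empty using (⊥-elim)
open import Data.Fin using (zero; suc; punchIn; punchOut)
open import Data.Fin.Properties using (punchIn-punchOut; _≟_)
open import Data.Fin.Subset using (Subset; _∪_; _∩_; _⊆_; ⁅_⁆; ∣_∣; _∈_; _∉_; ⊤; ⊥; inside; outside)
open import Data.Fin.Subset.Properties using (∣⁅x⁆∣≡1; x∈⁅y⁆⇒x≡y; ⊆⊤; ∪-identityʳ)
open import Data.List using (List; length; map; _++_)
open import Data.List.Properties using (length-++; length-map)
open import Data.List.Relation.Unary.All as All using (All)
import Data.List.Relation.Unary.All.Properties as All
open import Data.List.Relation.Unary.Any as Any using (Any)
import Data.List.Relation.Unary.Any.Properties as Any
open import Data.Nat using (_<_; _∸_)
open import Data.Nat.Properties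
  using (≤-antisym; <-≤-trans; ≰⇒>; <⇒≱; ∸-monoˡ-≤; m≤n+m∸n; m∸n+n≡m; +-comm; ≤∧≢⇒<)
import Data.Nat.Properties as ℕ
open import Data.Product using (_,_)
open import Data.Vec using (Vec; _∷_; insertAt; removeAt; lookup; zipWith)
open import Data.Vec.Properties using (insertAt-lookup; insertAt-punchIn; insertAt-removeAt; []=⇒lookup; lookup⇒[]=; lookup-replicate)
open import Relation.Binary.PropositionalEquality
open import Relation.Nullary using (Dec; yes; no; does)

private
  variable
    A B C : Set
    m : ℕ

∸-cancelʳ-< : ∀ {a b} c → a ∸ c < b ∸ c → a < b
∸-cancelʳ-< c h = ≰⇒> (λ b≤a → <⇒≱ h (∸-monoˡ-≤ c b≤a))

zipWith-insertAt : ∀ (f : A → B → C) (xs : Vec A m) (ys : Vec B m) (i : Fin (suc m)) x y →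
  zipWith f (insertAt xs i x) (insertAt ys i y) ≡ insertAt (zipWith f xs ys) i (f x y)
zipWith-insertAt f xs       ys       zero    x y = refl
zipWith-insertAt f (x′ ∷ xs) (y′ ∷ ys) (suc i) x y = cong (f x′ y′ ∷_) (zipWith-insertAt f xs ys i x y)

lookup-insertAt-≢ : ∀ (xs : Vec A m) {i j} x (i≢j : i ≢ j) → lookup (insertAt xs i x) j ≡ lookup xs (punchOut i≢j)
lookup-insertAt-≢ xs {i} x i≢j =
  trans (cong (lookup (insertAt xs i x)) (sym (punchIn-punchOut i≢j))) (insertAt-punchIn xs i x (punchOut i≢j))

∣insertAt-inside∣ : ∀ (p : Subset m) i → ∣ insertAt p i inside ∣ ≡ suc ∣ p ∣
∣insertAt-inside∣ p         zero    = refl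
∣insertAt-inside∣ (true ∷ p)  (suc i) = cong suc (∣insertAt-inside∣ p i)
∣insertAt-inside∣ (false ∷ p) (suc i) = ∣insertAt-inside∣ p i

∣insertAt-outside∣ : ∀ (p : Subset m) i → ∣ insertAt p i outside ∣ ≡ ∣ p ∣
∣insertAt-outside∣ p         zero    = refl
∣insertAt-outside∣ (true ∷ p)  (suc i) = cong suc (∣insertAt-outside∣ p i)
∣insertAt-outside∣ (false ∷ p) (suc i) = ∣insertAt-outside∣ p i

insertAt-⊤ : ∀ (i : Fin (suc m)) → insertAt ⊤ i inside ≡ ⊤
insertAt-⊤ {m}     zero    = refl
insertAt-⊤ {suc m} (suc i) = cong (true ∷_) (insertAt-⊤ i)

insertAt-⊥ : ∀ (i : Fin (suc m)) → insertAt ⊥ i outside ≡ ⊥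
insertAt-⊥ {m}     zero    = refl
insertAt-⊥ {suc m} (suc i) = cong (false ∷_) (insertAt-⊥ i)

⁅i⁆≡insertAt-⊥ : ∀ (i : Fin (suc m)) → ⁅ i ⁆ ≡ insertAt ⊥ i inside
⁅i⁆≡insertAt-⊥ {m}     zero    = refl
⁅i⁆≡insertAt-⊥ {suc m} (suc i) = cong (false ∷_) (⁅i⁆≡insertAt-⊥ i)

⁅punchIn⁆≡insertAt : ∀ (i : Fin (suc m)) j → ⁅ punchIn i j ⁆ ≡ insertAt ⁅ j ⁆ i outside
⁅punchIn⁆≡insertAt zero    j       = refl
⁅punchIn⁆≡insertAt (suc i) zero    = cong (true ∷_) (sym (insertAt-⊥ i))
⁅punchIn⁆≡insertAt (suc i) (suc j) = cong (false ∷_) (⁅punchIn⁆≡insertAt i j)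

module Element {n : ℕ} (e : Fin (suc n)) where

  withE withoutE : Subset n → Subset (suc n)
  withE X = insertAt X e inside
  withoutE X = insertAt X e outside

  e∈withE : ∀ X → e ∈ withE X
  e∈withE X = lookup⇒[]= e (withE X) (insertAt-lookup X e inside)

  ⁅e⁆⊆withE : ∀ X → ⁅ e ⁆ ⊆ withE X
  ⁅e⁆⊆withE X x∈⁅e⁆ with x∈⁅y⁆⇒x≡y e x∈⁅e⁆
  ... | refl = e∈withE X

  withoutE⊆withE : ∀ X → withoutE X ⊆ withE X
  withoutE⊆withE X {x} x∈ with e ≟ x
  ... | yes refl = e∈withE X
  ... | no e≢x = lookup⇒[]= x (withE X) (begin
    lookup (withE X) x                ≡⟨ lookup-insertAt-≢ X inside e≢x ⟩
    lookup X (punchOut e≢x)           ≡⟨ lookup-insertAt-≢ X outside e≢x ⟨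
    lookup (withoutE X) x             ≡⟨ []=⇒lookup x∈ ⟩
    true                              ∎)
    where open ≡-Reasoning

  withoutE∪⁅e⁆ : ∀ X → withoutE X ∪ ⁅ e ⁆ ≡ withE X
  withoutE∪⁅e⁆ X = begin
    withoutE X ∪ ⁅ e ⁆                       ≡⟨ cong (withoutE X ∪_) (⁅i⁆≡insertAt-⊥ e) ⟩
    withoutE X ∪ insertAt ⊥ e inside         ≡⟨ zipWith-insertAt _∨_ X ⊥ e false true ⟩
    withE (X ∪ ⊥)                            ≡⟨ cong withE (∪-identityʳ X) ⟩
    withE X                                  ∎
    where open ≡-Reasoning

  insertAt-∪⁅⁆ : ∀ X b {x} (e≢x : e ≢ x) → insertAt X e b ∪ ⁅ x ⁆ ≡ insertAt (X ∪ ⁅ punchOut e≢x ⁆) e b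
  insertAt-∪⁅⁆ X b {x} e≢x = begin
    insertAt X e b ∪ ⁅ x ⁆                          ≡⟨ cong (λ z → insertAt X e b ∪ ⁅ z ⁆) (sym (punchIn-punchOut e≢x)) ⟩
    insertAt X e b ∪ ⁅ punchIn e (punchOut e≢x) ⁆   ≡⟨ cong (insertAt X e b ∪_) (⁅punchIn⁆≡insertAt e (punchOut e≢x)) ⟩
    insertAt X e b ∪ withoutE ⁅ punchOut e≢x ⁆      ≡⟨ zipWith-insertAt _∨_ X ⁅ punchOut e≢x ⁆ e b false ⟩
    insertAt (X ∪ ⁅ punchOut e≢x ⁆) e (b ∨ false)   ≡⟨ cong (insertAt (X ∪ ⁅ punchOut e≢x ⁆) e) (∨-identityʳ b) ⟩
    insertAt (X ∪ ⁅ punchOut e≢x ⁆) e b             ∎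
    where open ≡-Reasoning

  ∉insertAt⇒punchOut∉ : ∀ X b {x} → x ∉ insertAt X e b → (e≢x : e ≢ x) → punchOut e≢x ∉ X
  ∉insertAt⇒punchOut∉ X b {x} x∉ e≢x y∈ =
    x∉ (lookup⇒[]= x (insertAt X e b) (trans (lookup-insertAt-≢ X b e≢x) ([]=⇒lookup y∈)))

  ∣withE∩withE∣ : ∀ X Y → ∣ withE X ∩ withE Y ∣ ≡ suc ∣ X ∩ Y ∣
  ∣withE∩withE∣ X Y = trans (cong ∣_∣ (zipWith-insertAt _∧_ X Y e true true)) (∣insertAt-inside∣ (X ∩ Y) e)

  ∣withoutE∩insertAt∣ : ∀ X Y b → ∣ withoutE X ∩ insertAt Y e b ∣ ≡ ∣ X ∩ Y ∣
  ∣withoutE∩insertAt∣ X Y b = trans (cong ∣_∣ (zipWith-insertAt _∧_ X Y e false b)) (∣insertAt-outside∣ (X ∩ Y) e)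

  isFlat-insertAt : ∀ (r : RankFn (suc n)) X b
    → (e ∉ insertAt X e b → r (insertAt X e b) < r (insertAt X e b ∪ ⁅ e ⁆))
    → (∀ y → y ∉ X → r (insertAt X e b) < r (insertAt (X ∪ ⁅ y ⁆) e b))
    → IsFlat r (insertAt X e b)
  isFlat-insertAt r X b at-e away-from-e x x∉ with e ≟ x
  ... | yes refl = at-e x∉
  ... | no e≢x rewrite insertAt-∪⁅⁆ X b e≢x = away-from-e (punchOut e≢x) (∉insertAt⇒punchOut∉ X b x∉ e≢x)

module Minors {n : ℕ} (r : RankFn (suc n)) (M : IsMatroid r) (e : Fin (suc n)) where
  open IsMatroid M
  open Element e

  rank⁅e⁆≤1 : r ⁅ e ⁆ ≤ 1
  rank⁅e⁆≤1 = subst (r ⁅ e ⁆ ≤_) (∣⁅x⁆∣≡1 e) (rank-≤-card ⁅ e ⁆)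

  ¬loop⇒rank⁅e⁆≡1 : ¬ IsLoop r e → r ⁅ e ⁆ ≡ 1
  ¬loop⇒rank⁅e⁆≡1 ¬loop with r ⁅ e ⁆ ℕ.≟ ∣ ⁅ e ⁆ ∣
  ... | yes indep = trans indep (∣⁅x⁆∣≡1 e)
  ... | no dep = ⊥-elim (¬loop dep)

  -- A basis avoiding e lies in E − e, so r(E − e) < r(E) forces e into every basis.
  ¬coloop⇒rank-withoutE-⊤ : ¬ IsColoop r e → r (withoutE ⊤) ≡ r ⊤
  ¬coloop⇒rank-withoutE-⊤ ¬coloop with r (withoutE ⊤) ℕ.≟ r ⊤
  ... | yes eq = eq
  ... | no neq = ⊥-elim (¬coloop coloop)
    where
    coloop : IsColoop r e
    coloop B (indep , card) with lookup B e Bool.≟ true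
    ... | yes e∈B = lookup⇒[]= e B e∈B
    ... | no e∉B = ⊥-elim (neq (≤-antisym (rank-mono _ _ ⊆⊤)
                                           (subst (_≤ r (withoutE ⊤)) (trans indep card) (rank-mono _ _ B⊆E−e))))
      where
      B⊆E−e : B ⊆ withoutE ⊤
      B⊆E−e {x} x∈B with e ≟ x
      ... | yes refl = ⊥-elim (e∉B ([]=⇒lookup x∈B))
      ... | no e≢x = lookup⇒[]= x (withoutE ⊤) (trans (lookup-insertAt-≢ ⊤ outside e≢x) (lookup-replicate (punchOut e≢x) true))

  contract-flat⇒withE-flat : ∀ F → IsFlat (contract r e) F → IsFlat r (withE F)
  contract-flat⇒withE-flat F flat =
    isFlat-insertAt r F true (λ e∉ → ⊥-elim (e∉ (e∈withE F))) (λ y y∉ → ∸-cancelʳ-< (r ⁅ e ⁆) (flat y y∉))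

  closure : Subset n → Subset (suc n)
  closure F = insertAt F e (does (r (withE F) ℕ.≟ r (withoutE F)))

  rank-closure : ∀ F → r (closure F) ≡ r (withoutE F)
  rank-closure F = rank-insertAt (r (withE F) ℕ.≟ r (withoutE F))
    where
    rank-insertAt : (d : Dec (r (withE F) ≡ r (withoutE F))) → r (insertAt F e (does d)) ≡ r (withoutE F)
    rank-insertAt (yes eq) = eq
    rank-insertAt (no _) = refl

  delete-flat⇒closure-flat : ∀ F → IsFlat (delete r e) F → IsFlat r (closure F)
  delete-flat⇒closure-flat F flat = flat-insertAt (r (withE F) ℕ.≟ r (withoutE F))
    where
    flat-insertAt : (d : Dec (r (withE F) ≡ r (withoutE F))) → IsFlat r (insertAt F e (does d))
    flat-insertAt (yes eq) = isFlat-insertAt r F true (λ e∉ → ⊥-elim (e∉ (e∈withE F)))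
      (λ y y∉ → subst (_< r (withE (F ∪ ⁅ y ⁆))) (sym eq) (<-≤-trans (flat y y∉) (rank-mono _ _ (withoutE⊆withE _))))
    flat-insertAt (no neq) = isFlat-insertAt r F false
      (λ _ → subst (λ Z → r (withoutE F) < r Z) (sym (withoutE∪⁅e⁆ F))
                   (≤∧≢⇒< (rank-mono _ _ (withoutE⊆withE F)) (λ eq → neq (sym eq))))
      flat

  covers-withE : ∀ F Y → Covers (contract r e) F Y → Covers r (withE F) (withE Y)
  covers-withE F Y covers = subst (r (withE F) <_) (sym (∣withE∩withE∣ Y F)) (begin-strict
    r (withE F)                      ≤⟨ m≤n+m∸n (r (withE F)) (r ⁅ e ⁆) ⟩
    r ⁅ e ⁆ + (r (withE F) ∸ r ⁅ e ⁆) <⟨ ℕ.+-mono-≤-< rank⁅e⁆≤1 covers ⟩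
    suc ∣ Y ∩ F ∣                     ∎)
    where open ℕ.≤-Reasoning

  covers-closure : ∀ F Y → Covers (delete r e) F Y → Covers r (closure F) (withoutE Y)
  covers-closure F Y covers =
    subst₂ _<_ (sym (rank-closure F)) (sym (∣withoutE∩insertAt∣ Y F _)) covers

  contract-independent⇒withE-independent : r ⁅ e ⁆ ≡ 1 → ∀ Y → Independent (contract r e) Y → Independent r (withE Y)
  contract-independent⇒withE-independent rank⁅e⁆≡1 Y indep = begin
    r (withE Y)                       ≡⟨ m∸n+n≡m 1≤rank ⟨
    r (withE Y) ∸ 1 + 1               ≡⟨ cong (λ c → r (withE Y) ∸ c + 1) rank⁅e⁆≡1 ⟨
    r (withE Y) ∸ r ⁅ e ⁆ + 1         ≡⟨ cong (_+ 1) indep ⟩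
    ∣ Y ∣ + 1                         ≡⟨ +-comm ∣ Y ∣ 1 ⟩
    suc ∣ Y ∣                         ≡⟨ ∣insertAt-inside∣ Y e ⟨
    ∣ withE Y ∣                       ∎
    where
    open ≡-Reasoning
    1≤rank : 1 ≤ r (withE Y)
    1≤rank = subst (_≤ r (withE Y)) rank⁅e⁆≡1 (rank-mono _ _ (⁅e⁆⊆withE Y))

  withE-nonBasis⇒contract-nonBasis : r ⁅ e ⁆ ≡ 1 → ∀ Y → IsNonBasis r (withE Y) → IsNonBasis (contract r e) Y
  withE-nonBasis⇒contract-nonBasis rank⁅e⁆≡1 Y (card , ¬basis) = card′ , ¬basis′
    where
    card′ : ∣ Y ∣ ≡ r (withE ⊤) ∸ r ⁅ e ⁆
    card′ = begin
      ∣ Y ∣                    ≡⟨⟩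
      suc ∣ Y ∣ ∸ 1            ≡⟨ cong (_∸ 1) (trans (sym (∣insertAt-inside∣ Y e)) card) ⟩
      r ⊤ ∸ 1                  ≡⟨ cong₂ (λ X c → r X ∸ c) (insertAt-⊤ e) rank⁅e⁆≡1 ⟨
      r (withE ⊤) ∸ r ⁅ e ⁆    ∎
      where open ≡-Reasoning
    ¬basis′ : ¬ IsBasis (contract r e) Y
    ¬basis′ (indep , _) = ¬basis (contract-independent⇒withE-independent rank⁅e⁆≡1 Y indep , card)

  withoutE-nonBasis⇒delete-nonBasis : r (withoutE ⊤) ≡ r ⊤ → ∀ Y → IsNonBasis r (withoutE Y) → IsNonBasis (delete r e) Y
  withoutE-nonBasis⇒delete-nonBasis rank-withoutE-⊤ Y (card , ¬basis) = card′ , ¬basis′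
    where
    card′ : ∣ Y ∣ ≡ r (withoutE ⊤)
    card′ = trans (sym (∣insertAt-outside∣ Y e)) (trans card (sym rank-withoutE-⊤))
    ¬basis′ : ¬ IsBasis (delete r e) Y
    ¬basis′ (indep , _) = ¬basis (trans indep (sym (∣insertAt-outside∣ Y e)) , card)

  flatCover-lift : r ⁅ e ⁆ ≡ 1 → r (withoutE ⊤) ≡ r ⊤
    → ∀ {C/ C\} → IsFlatCover (contract r e) C/ → IsFlatCover (delete r e) C\
    → IsFlatCover r (map withE C/ ++ map closure C\)
  flatCover-lift rank⁅e⁆≡1 rank-withoutE-⊤ {C/} {C\} (flats/ , covers/) (flats\ , covers\) = flats , covers
    where
    flats : All (IsFlat r) (map withE C/ ++ map closure C\)
    flats = All.++⁺ (All.map⁺ (All.map (contract-flat⇒withE-flat _) flats/))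
                    (All.map⁺ (All.map (delete-flat⇒closure-flat _) flats\))

    coveredAt : ∀ Y b → IsNonBasis r (insertAt Y e b) → Any (λ F → Covers r F (insertAt Y e b)) (map withE C/ ++ map closure C\)
    coveredAt Y true nonBasis = Any.++⁺ˡ (Any.map⁺ (Any.map (covers-withE _ Y)
      (covers/ Y (withE-nonBasis⇒contract-nonBasis rank⁅e⁆≡1 Y nonBasis))))
    coveredAt Y false nonBasis = Any.++⁺ʳ (map withE C/) (Any.map⁺ (Any.map (covers-closure _ Y)
      (covers\ Y (withoutE-nonBasis⇒delete-nonBasis rank-withoutE-⊤ Y nonBasis))))

    covers : ∀ X → IsNonBasis r X → Any (λ F → Covers r F X) (map withE C/ ++ map closure C\)
    covers X nonBasis rewrite sym (insertAt-removeAt X e) =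
      coveredAt (removeAt X e) (lookup X e) nonBasis

lemma3p5 : ∀ {n} (r : RankFn (suc n)) → IsMatroid r → (e : Fin (suc n))
    → ¬ IsLoop r e → ¬ IsColoop r e
    → ∀ k k/ k\ → IsCoverComplexity r k
    → IsCoverComplexity (contract r e) k/
    → IsCoverComplexity (delete r e) k\
    → k ≤ k/ + k\
lemma3p5 {n} r M e ¬loop ¬coloop k k/ k\ (_ , minimal) ((C/ , cover/ , refl) , _) ((C\ , cover\ , refl) , _) =
  subst (k ≤_) length-lift (minimal lift lift-isFlatCover)
  where
  open Element e
  open Minors r M e
  lift : List (Subset (suc n))
  lift = map withE C/ ++ map closure C\
  lift-isFlatCover : IsFlatCover r lift
  lift-isFlatCover =
    flatCover-lift (¬loop⇒rank⁅e⁆≡1 ¬loop) (¬coloop⇒rank-withoutE-⊤ ¬coloop) cover/ cover\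
  length-lift : length lift ≡ length C/ + length C\
  length-lift = trans (length-++ (map withE C/)) (cong₂ _+_ (length-map withE C/) (length-map closure C\))
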